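{- Let $\mathcal T_1,\mathcal T_2$ be sets of difference equalities with $\mathcal T_1\cap\mathcal T_2\neq\emptyset$, such that $\mathcal T_1\cup\mathcal T_2$ is linearly independent and $2$-good. If $\mathcal T_1$ and $\mathcal T_2$ are both $2$-full, then $\mathcal T_1\cap\mathcal T_2$ is $2$-full.
   Context: All linear equations are over $\mathbb Q$ in variables $x_1,\dots,x_k$, considered up to rearrangement but not scaling; the content of an equation is an expression $*$ with the equation reading $*=0$. Equations are (linearly) independent if their contents are linearly independent; a collection implies an equation if its content is a $\mathbb Q$-linear combination of the contents of the collection. An equation contains a variable if its coefficient is nonzero. A difference equality is a nontrivial equation $x_{i_1}-x_{i_2}=x_{i_3}-x_{i_4}$ ($i_1,\dots,i_4\in[k]$ not necessarily distinct). A collection is valid if it does not imply $x_a=x_b$ for $a\ne b$; collinearity-free if it implies no equation containing exactly three variables; $2$-light if for every $t\ge1$ any $t$ independent equations it implies together contain at least $2t+1$ variables; $2$-good if valid, collinearity-free and $2$-light. A collection of $t$ linearly independent difference equalities is $2$-full if the equations together contain exactly $2t+1$ variables. -}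

module Defs where

open import Data.Nat using (ℕ; zero; suc; _≥_; _+_; _*_)
import Data.Fin
import Data.Bool
open import Data.Fin using (Fin; zero; suc)
import Data.Fin.Subset.Properties
open import Data.Fin.Subset using (Subset; _∈_; _∉_; ∣_∣; inside; outside; ⊤)
open import Data.Bool using (Bool; true; false; _∧_; _∨_; if_then_else_)
open import Data.Vec using (tabulate)
open import Data.Rational using (ℚ; 0ℚ; 1ℚ; _≟_)
  renaming (_+_ to _+ℚ_; _*_ to _*ℚ_; _-_ to _-ℚ_)
open import Data.Product using (∃; _×_)
open import Relation.Nullary using (¬_; does)
open import Relation.Binary.PropositionalEquality using (_≡_; _≢_)

-- The content of a (homogeneous) linear equation over ℚ in variables x_1..x_k:
-- the coefficient vector of the expression * in "* = 0".
Content : ℕ → Set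
Content k = Fin k → ℚ

Σ : ∀ {n} → (Fin n → ℚ) → ℚ
Σ {zero}  f = 0ℚ
Σ {suc n} f = f zero +ℚ Σ (λ j → f (suc j))

anyFin : ∀ {n} → (Fin n → Bool) → Bool
anyFin {zero}  f = false
anyFin {suc n} f = f zero ∨ anyFin (λ j → f (suc j))

unit : ∀ {k} → Fin k → Content k
unit i j = if does (Data.Fin._≟_ i j) then 1ℚ else 0ℚ

-- content of the equation x_{i1} - x_{i2} = x_{i3} - x_{i4}
diffContent : ∀ {k} → Fin k → Fin k → Fin k → Fin k → Content k
diffContent i₁ i₂ i₃ i₄ j =
  ((unit i₁ j -ℚ unit i₂ j) -ℚ unit i₃ j) +ℚ unit i₄ j

IsZero : ∀ {k} → Content k → Set
IsZero c = ∀ j → c j ≡ 0ℚ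

IsDiffEq : ∀ {k} → Content k → Set
IsDiffEq c = ∃ λ i₁ → ∃ λ i₂ → ∃ λ i₃ → ∃ λ i₄ →
  (∀ j → c j ≡ diffContent i₁ i₂ i₃ i₄ j) × ¬ IsZero c

lincomb : ∀ {n k} → (Fin n → ℚ) → (Fin n → Content k) → Content k
lincomb λs E i = Σ (λ j → λs j *ℚ E j i)

SupportedOn : ∀ {n} → (Fin n → ℚ) → Subset n → Set
SupportedOn λs S = ∀ j → j ∉ S → λs j ≡ 0ℚ

LinIndep : ∀ {n k} → (Fin n → Content k) → Subset n → Set
LinIndep E S = ∀ λs → SupportedOn λs S → IsZero (lincomb λs E) → ∀ j → λs j ≡ 0ℚ

Implies : ∀ {n k} → (Fin n → Content k) → Subset n → Content k → Set
Implies E S c = ∃ λ λs → SupportedOn λs S × (∀ i → c i ≡ lincomb λs E i)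

vars : ∀ {n k} → (Fin n → Content k) → Subset n → Subset k
vars {n} E S = tabulate λ i →
  anyFin (λ j → does (Data.Fin.Subset.Properties._∈?_ j S) ∧ Data.Bool.not (does (E j i ≟ 0ℚ)))

numVars : ∀ {k} → Content k → ℕ
numVars {k} c = ∣ vars {1} (λ _ → c) ⊤ ∣

Valid : ∀ {n k} → (Fin n → Content k) → Subset n → Set
Valid E S = ∀ a b → a ≢ b → ¬ Implies E S (λ i → unit a i -ℚ unit b i)

CollinearityFree : ∀ {n k} → (Fin n → Content k) → Subset n → Set
CollinearityFree E S = ∀ c → Implies E S c → numVars c ≢ 3

TwoLight : ∀ {n k} → (Fin n → Content k) → Subset n → Set
TwoLight E S = ∀ t → t ≥ 1 → (F : Fin t → Content _) →
  (∀ r → Implies E S (F r)) → LinIndep F ⊤ → ∣ vars F ⊤ ∣ ≥ 2 * t + 1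

TwoGood : ∀ {n k} → (Fin n → Content k) → Subset n → Set
TwoGood E S = Valid E S × CollinearityFree E S × TwoLight E S

TwoFull : ∀ {n k} → (Fin n → Content k) → Subset n → Set
TwoFull E S = (∀ j → j ∈ S → IsDiffEq (E j)) × LinIndep E S ×
  (∣ vars E S ∣ ≡ 2 * ∣ S ∣ + 1)

{-# OPTIONS --safe #-}
-- Write Vᵢ for the variables of Tᵢ. Every variable of T₁ ∩ T₂ lies in V₁ ∩ V₂ and
-- every variable of T₁ ∪ T₂ in V₁ ∪ V₂, so inclusion–exclusion and 2-fullness give
--   |vars (T₁ ∩ T₂)| + |vars (T₁ ∪ T₂)| ≤ |V₁| + |V₂| = 2 (|T₁ ∩ T₂| + |T₁ ∪ T₂|) + 2.
-- Lightness of the independent subcollection T₁ ∪ T₂ bounds its variable count below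
-- by 2 |T₁ ∪ T₂| + 1, leaving |vars (T₁ ∩ T₂)| ≤ 2 |T₁ ∩ T₂| + 1; lightness of
-- T₁ ∩ T₂ itself gives the reverse inequality.
module Submission where

open import Defs
open import Data.Bool using (Bool; true; false; _∧_; not)
open import Data.Bool.Properties using (∨-zeroʳ)
open import Data.Empty using (⊥-elim)
open import Data.Fin using (Fin; zero; suc)
open import Data.Fin.Subset
  using (Subset; _∩_; _∪_; ⊤; Nonempty; _∈_; _∉_; ∣_∣; inside; outside; _⊆_)
open import Data.Fin.Subset.Properties
  using (_∈?_; ∈⊤; drop-there; x∈p∩q⁺; x∈p∩q⁻; x∈p∪q⁻; x∈p∪q⁺; p∩q⊆p; p⊆p∪q;
         p⊆q⇒∣p∣≤∣q∣; x∈p⇒∣p-x∣<∣p∣)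
open import Data.Nat using (ℕ; _+_; _*_; _≤_; z≤n)
open import Data.Nat.Properties
  using (+-suc; +-cancelˡ-≤; +-monoˡ-≤; ≤-trans; ≤-reflexive; ≤-antisym; ≤-<-trans)
open import Data.Nat.Tactic.RingSolver using (solve-∀)
open import Data.Product using (∃; _×_; _,_; proj₁; proj₂)
open import Data.Rational using (ℚ; 0ℚ; _≟_) renaming (_+_ to _+ℚ_; _*_ to _*ℚ_)
open import Data.Rational.Properties using (+-identityˡ; +-identityʳ; *-identityˡ; *-zeroˡ)
open import Data.Sum using (inj₁; inj₂)
open import Data.Vec using (_∷_; []; tabulate; here; there)
open import Data.Vec.Properties using (lookup∘tabulate; []=⇒lookup; lookup⇒[]=)
open import Function using (_∘_)
open import Relation.Nullary using (yes; no)
open import Relation.Nullary.Decidable using (dec-true; dec-false)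
open import Relation.Binary.PropositionalEquality
  using (_≡_; _≢_; refl; sym; trans; cong; cong₂; module ≡-Reasoning)

Σ-cong : ∀ {n} {f g : Fin n → ℚ} → (∀ j → f j ≡ g j) → Σ f ≡ Σ g
Σ-cong {ℕ.zero} f≗g = refl
Σ-cong {ℕ.suc n} f≗g = cong₂ _+ℚ_ (f≗g zero) (Σ-cong (f≗g ∘ suc))

Σ-zero : ∀ {n} {f : Fin n → ℚ} → (∀ j → f j ≡ 0ℚ) → Σ f ≡ 0ℚ
Σ-zero {ℕ.zero} f≗0 = refl
Σ-zero {ℕ.suc n} f≗0 =
  trans (cong₂ _+ℚ_ (f≗0 zero) (Σ-zero (f≗0 ∘ suc))) (+-identityˡ 0ℚ)

Σ-unit : ∀ {n} (a : Fin n) (g : Fin n → ℚ) → Σ (λ j → unit a j *ℚ g j) ≡ g a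
Σ-unit zero g =
  trans (cong₂ _+ℚ_ (*-identityˡ (g zero)) (Σ-zero (*-zeroˡ ∘ g ∘ suc))) (+-identityʳ (g zero))
Σ-unit (suc a) g =
  trans (cong₂ _+ℚ_ (*-zeroˡ (g zero)) (Σ-unit a (g ∘ suc))) (+-identityˡ (g (suc a)))

anyFin⁻ : ∀ {n} (f : Fin n → Bool) → anyFin f ≡ true → ∃ λ j → f j ≡ true
anyFin⁻ {ℕ.zero} f ()
anyFin⁻ {ℕ.suc n} f any with f zero in f0
... | true  = zero , f0
... | false = let j , fj = anyFin⁻ (f ∘ suc) any in suc j , fj

anyFin⁺ : ∀ {n} (f : Fin n → Bool) j → f j ≡ true → anyFin f ≡ true
anyFin⁺ f zero    fj rewrite fj = refl
anyFin⁺ f (suc j) fj rewrite anyFin⁺ (f ∘ suc) j fj = ∨-zeroʳ (f zero)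

∈-tabulate⁻ : ∀ {k} (g : Fin k → Bool) {i} → i ∈ tabulate g → g i ≡ true
∈-tabulate⁻ g {i} i∈g = trans (sym (lookup∘tabulate g i)) ([]=⇒lookup i∈g)

∈-tabulate⁺ : ∀ {k} (g : Fin k → Bool) {i} → g i ≡ true → i ∈ tabulate g
∈-tabulate⁺ g {i} gi = lookup⇒[]= i (tabulate g) (trans (lookup∘tabulate g i) gi)

module _ {n k} (E : Fin n → Content k) where

  ∈-vars⁻ : ∀ {S i} → i ∈ vars E S → ∃ λ j → j ∈ S × E j i ≢ 0ℚ
  ∈-vars⁻ {S} {i} i∈V with anyFin⁻ _ (∈-tabulate⁻ _ i∈V)
  ... | j , contains with j ∈? S | E j i ≟ 0ℚ | contains
  ...   | yes j∈S | no Eji≢0 | _ = j , j∈S , Eji≢0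
  ...   | yes _   | yes _    | ()
  ...   | no _    | _        | ()

  ∈-vars⁺ : ∀ {S i j} → j ∈ S → E j i ≢ 0ℚ → i ∈ vars E S
  ∈-vars⁺ {S} {i} {j} j∈S Eji≢0 = ∈-tabulate⁺ _ (anyFin⁺ _ j
    (cong₂ _∧_ (dec-true (j ∈? S) j∈S) (cong not (dec-false (E j i ≟ 0ℚ) Eji≢0))))

  vars-mono : ∀ {S T} → S ⊆ T → vars E S ⊆ vars E T
  vars-mono S⊆T i∈V = let j , j∈S , Eji≢0 = ∈-vars⁻ i∈V in ∈-vars⁺ (S⊆T j∈S) Eji≢0

  vars-∩ : ∀ S T → vars E (S ∩ T) ⊆ vars E S ∩ vars E T
  vars-∩ S T i∈V = x∈p∩q⁺ ( vars-mono (proj₁ ∘ x∈p∩q⁻ S T) i∈V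
                          , vars-mono (proj₂ ∘ x∈p∩q⁻ S T) i∈V)

  vars-∪ : ∀ S T → vars E (S ∪ T) ⊆ vars E S ∪ vars E T
  vars-∪ S T i∈V with ∈-vars⁻ i∈V
  ... | j , j∈S∪T , Eji≢0 with x∈p∪q⁻ S T j∈S∪T
  ...   | inj₁ j∈S = x∈p∪q⁺ (inj₁ (∈-vars⁺ j∈S Eji≢0))
  ...   | inj₂ j∈T = x∈p∪q⁺ (inj₂ (∈-vars⁺ j∈T Eji≢0))

  Implies-∈ : ∀ {S j} → j ∈ S → Implies E S (E j)
  Implies-∈ {S} {j} j∈S =
    unit j , unit-supported , λ i → sym (Σ-unit j (λ j′ → E j′ i))
    where
    unit-supported : SupportedOn (unit j) S
    unit-supported j′ j′∉S with j Data.Fin.≟ j′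
    ... | yes refl = ⊥-elim (j′∉S j∈S)
    ... | no _     = refl

  LinIndep-mono : ∀ {S T} → S ⊆ T → LinIndep E T → LinIndep E S
  LinIndep-mono S⊆T indep λs supp = indep λs (λ j j∉T → supp j (j∉T ∘ S⊆T))

enumerate : ∀ {n} (S : Subset n) → Fin ∣ S ∣ → Fin n
enumerate (inside  ∷ S) zero    = zero
enumerate (inside  ∷ S) (suc r) = suc (enumerate S r)
enumerate (outside ∷ S) r       = suc (enumerate S r)

enumerate-∈ : ∀ {n} (S : Subset n) r → enumerate S r ∈ S
enumerate-∈ (inside  ∷ S) zero    = here
enumerate-∈ (inside  ∷ S) (suc r) = there (enumerate-∈ S r)
enumerate-∈ (outside ∷ S) r       = there (enumerate-∈ S r)

Σ-enumerate : ∀ {n} (S : Subset n) (h : Fin n → ℚ) → (∀ j → j ∉ S → h j ≡ 0ℚ) →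
  Σ h ≡ Σ (h ∘ enumerate S)
Σ-enumerate []            h h≗0 = refl
Σ-enumerate (inside  ∷ S) h h≗0 =
  cong (h zero +ℚ_) (Σ-enumerate S (h ∘ suc) (λ j j∉S → h≗0 (suc j) (j∉S ∘ drop-there)))
Σ-enumerate (outside ∷ S) h h≗0 =
  trans (cong₂ _+ℚ_ (h≗0 zero λ ()) (Σ-enumerate S (h ∘ suc) (λ j j∉S → h≗0 (suc j) (j∉S ∘ drop-there))))
        (+-identityˡ _)

extend : ∀ {n} (S : Subset n) → (Fin ∣ S ∣ → ℚ) → Fin n → ℚ
extend (inside  ∷ S) μ zero    = μ zero
extend (inside  ∷ S) μ (suc j) = extend S (μ ∘ suc) j
extend (outside ∷ S) μ zero    = 0ℚ
extend (outside ∷ S) μ (suc j) = extend S μ j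

extend-enumerate : ∀ {n} (S : Subset n) μ r → extend S μ (enumerate S r) ≡ μ r
extend-enumerate (inside  ∷ S) μ zero    = refl
extend-enumerate (inside  ∷ S) μ (suc r) = extend-enumerate S (μ ∘ suc) r
extend-enumerate (outside ∷ S) μ r       = extend-enumerate S μ r

extend-supported : ∀ {n} (S : Subset n) μ → SupportedOn (extend S μ) S
extend-supported (inside  ∷ S) μ zero    j∉S = ⊥-elim (j∉S here)
extend-supported (inside  ∷ S) μ (suc j) j∉S = extend-supported S (μ ∘ suc) j (j∉S ∘ there)
extend-supported (outside ∷ S) μ zero    j∉S = refl
extend-supported (outside ∷ S) μ (suc j) j∉S = extend-supported S μ j (j∉S ∘ there)

module _ {n k} (E : Fin n → Content k) where

  lincomb-extend : ∀ (S : Subset n) μ i →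
    lincomb (extend S μ) E i ≡ lincomb μ (E ∘ enumerate S) i
  lincomb-extend S μ i = trans
    (Σ-enumerate S _ λ j j∉S → trans (cong (_*ℚ E j i) (extend-supported S μ j j∉S)) (*-zeroˡ (E j i)))
    (Σ-cong λ r → cong (_*ℚ E (enumerate S r) i) (extend-enumerate S μ r))

  LinIndep-enumerate : ∀ {S} → LinIndep E S → LinIndep (E ∘ enumerate S) ⊤
  LinIndep-enumerate {S} indep μ _ μE≡0 r = begin
    μ r                          ≡⟨ sym (extend-enumerate S μ r) ⟩
    extend S μ (enumerate S r)   ≡⟨ indep (extend S μ) (extend-supported S μ)
                                      (λ i → trans (lincomb-extend S μ i) (μE≡0 i)) _ ⟩
    0ℚ                           ∎
    where open ≡-Reasoning

  vars-enumerate : ∀ S → vars (E ∘ enumerate S) ⊤ ⊆ vars E S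
  vars-enumerate S i∈V = let r , _ , Eri≢0 = ∈-vars⁻ (E ∘ enumerate S) i∈V
                         in ∈-vars⁺ E (enumerate-∈ S r) Eri≢0

  TwoLight⇒vars-lowerBound : ∀ {S U} → S ⊆ U → LinIndep E S → TwoLight E U → Nonempty S →
    2 * ∣ S ∣ + 1 ≤ ∣ vars E S ∣
  TwoLight⇒vars-lowerBound {S} S⊆U indep light (x , x∈S) = ≤-trans
    (light ∣ S ∣ (≤-<-trans z≤n (x∈p⇒∣p-x∣<∣p∣ x∈S)) (E ∘ enumerate S)
       (λ r → Implies-∈ E (S⊆U (enumerate-∈ S r))) (LinIndep-enumerate indep))
    (p⊆q⇒∣p∣≤∣q∣ (vars-enumerate S))

∣p∪q∣+∣p∩q∣≡∣p∣+∣q∣ : ∀ {n} (p q : Subset n) → ∣ p ∪ q ∣ + ∣ p ∩ q ∣ ≡ ∣ p ∣ + ∣ q ∣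
∣p∪q∣+∣p∩q∣≡∣p∣+∣q∣ []            []            = refl
∣p∪q∣+∣p∩q∣≡∣p∣+∣q∣ (inside  ∷ p) (inside  ∷ q) = cong ℕ.suc (begin
  ∣ p ∪ q ∣ + ℕ.suc ∣ p ∩ q ∣   ≡⟨ +-suc _ _ ⟩
  ℕ.suc (∣ p ∪ q ∣ + ∣ p ∩ q ∣) ≡⟨ cong ℕ.suc (∣p∪q∣+∣p∩q∣≡∣p∣+∣q∣ p q) ⟩
  ℕ.suc (∣ p ∣ + ∣ q ∣)         ≡⟨ +-suc _ _ ⟨
  ∣ p ∣ + ℕ.suc ∣ q ∣           ∎)
  where open ≡-Reasoning
∣p∪q∣+∣p∩q∣≡∣p∣+∣q∣ (inside  ∷ p) (outside ∷ q) = cong ℕ.suc (∣p∪q∣+∣p∩q∣≡∣p∣+∣q∣ p q)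
∣p∪q∣+∣p∩q∣≡∣p∣+∣q∣ (outside ∷ p) (inside  ∷ q) =
  trans (cong ℕ.suc (∣p∪q∣+∣p∩q∣≡∣p∣+∣q∣ p q)) (sym (+-suc _ _))
∣p∪q∣+∣p∩q∣≡∣p∣+∣q∣ (outside ∷ p) (outside ∷ q) = ∣p∪q∣+∣p∩q∣≡∣p∣+∣q∣ p q

m+n≡o+p⇒o≤m⇒n≤p : ∀ {m n o p} → m + n ≡ o + p → o ≤ m → n ≤ p
m+n≡o+p⇒o≤m⇒n≤p {m} {n} {o} {p} eq o≤m =
  +-cancelˡ-≤ o n p (≤-trans (+-monoˡ-≤ n o≤m) (≤-reflexive eq))

[2m+1]+[2n+1]≡2[m+n]+2 : ∀ m n → (2 * m + 1) + (2 * n + 1) ≡ 2 * (m + n) + 2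
[2m+1]+[2n+1]≡2[m+n]+2 = solve-∀

vars-∩-upperBound : ∀ {n k} (E : Fin n → Content k) (T₁ T₂ : Subset n) →
  ∣ vars E T₁ ∣ ≡ 2 * ∣ T₁ ∣ + 1 → ∣ vars E T₂ ∣ ≡ 2 * ∣ T₂ ∣ + 1 →
  2 * ∣ T₁ ∪ T₂ ∣ + 1 ≤ ∣ vars E (T₁ ∪ T₂) ∣ →
  ∣ vars E (T₁ ∩ T₂) ∣ ≤ 2 * ∣ T₁ ∩ T₂ ∣ + 1
vars-∩-upperBound E T₁ T₂ full₁ full₂ light∪ = ≤-trans
  (p⊆q⇒∣p∣≤∣q∣ (vars-∩ E T₁ T₂))
  (m+n≡o+p⇒o≤m⇒n≤p counts (≤-trans light∪ (p⊆q⇒∣p∣≤∣q∣ (vars-∪ E T₁ T₂))))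
  where
  V₁ = vars E T₁
  V₂ = vars E T₂
  open ≡-Reasoning
  counts : ∣ V₁ ∪ V₂ ∣ + ∣ V₁ ∩ V₂ ∣ ≡ (2 * ∣ T₁ ∪ T₂ ∣ + 1) + (2 * ∣ T₁ ∩ T₂ ∣ + 1)
  counts = begin
    ∣ V₁ ∪ V₂ ∣ + ∣ V₁ ∩ V₂ ∣                        ≡⟨ ∣p∪q∣+∣p∩q∣≡∣p∣+∣q∣ V₁ V₂ ⟩
    ∣ V₁ ∣ + ∣ V₂ ∣                                  ≡⟨ cong₂ _+_ full₁ full₂ ⟩
    (2 * ∣ T₁ ∣ + 1) + (2 * ∣ T₂ ∣ + 1)              ≡⟨ [2m+1]+[2n+1]≡2[m+n]+2 ∣ T₁ ∣ ∣ T₂ ∣ ⟩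
    2 * (∣ T₁ ∣ + ∣ T₂ ∣) + 2                        ≡⟨ cong (λ m → 2 * m + 2) (∣p∪q∣+∣p∩q∣≡∣p∣+∣q∣ T₁ T₂) ⟨
    2 * (∣ T₁ ∪ T₂ ∣ + ∣ T₁ ∩ T₂ ∣) + 2              ≡⟨ [2m+1]+[2n+1]≡2[m+n]+2 ∣ T₁ ∪ T₂ ∣ ∣ T₁ ∩ T₂ ∣ ⟨
    (2 * ∣ T₁ ∪ T₂ ∣ + 1) + (2 * ∣ T₁ ∩ T₂ ∣ + 1)    ∎

lemma5p3 : ∀ {n k} (E : Fin n → Content k) (T₁ T₂ : Subset n) →
    (∀ j → IsDiffEq (E j)) → T₁ ∪ T₂ ≡ ⊤ → Nonempty (T₁ ∩ T₂) →
    LinIndep E ⊤ → TwoGood E ⊤ → TwoFull E T₁ → TwoFull E T₂ →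
    TwoFull E (T₁ ∩ T₂)
lemma5p3 E T₁ T₂ diff _ (x , x∈T₁∩T₂) indep (_ , _ , light) (_ , _ , full₁) (_ , _ , full₂) =
  (λ j _ → diff j) , indep-sub ,
  ≤-antisym (vars-∩-upperBound E T₁ T₂ full₁ full₂ (lowerBound (x , x∈T₁∪T₂)))
            (lowerBound (x , x∈T₁∩T₂))
  where
  indep-sub : ∀ {S} → LinIndep E S
  indep-sub = LinIndep-mono E (λ _ → ∈⊤) indep
  lowerBound : ∀ {S} → Nonempty S → 2 * ∣ S ∣ + 1 ≤ ∣ vars E S ∣
  lowerBound = TwoLight⇒vars-lowerBound E (λ _ → ∈⊤) indep-sub light
  x∈T₁∪T₂ : x ∈ T₁ ∪ T₂
  x∈T₁∪T₂ = p⊆p∪q T₂ (p∩q⊆p T₁ T₂ x∈T₁∩T₂)
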